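{- Let $\mathbf{M}=(M;\leq,0,1)$ be a non-trivial complete lattice, let $S$ be a non-empty set, and let $\mathbf{A}$ and $\mathbf{B}$ be bounded subposets of $\mathbf{M}^{S}$. Let $P\colon A\to M^{S}$ and $T\colon B\to M^{S}$ be order-preserving mappings such that for all $a\in A$ and all $b\in B$: $P(a)\leq b$ if and only if $a\leq T(b)$. Then: (a) If $P(A)\subseteq B$, then $R_T\subseteq R^{P}$. (b) If $T(B)\subseteq A$, then $R^{P}\subseteq R_T$. (c) If $P(A)\subseteq B$ and $T(B)\subseteq A$, then $R_T=R^{P}$.
   Context: Non-trivial means $0\neq 1$. $\mathbf{M}^S$ is ordered componentwise; a bounded subposet of $\mathbf{M}^S$ is a subset containing the constant tuples $0$ and $1$ with the inherited order. For $s\in S$ and $m\in M^S$, $s(m)$ denotes the $s$-th component of $m$. For $T\colon B\to M^S$, $R_T=\{(s,t)\in S\times S\mid \forall b\in B:\ s(T(b))\leq t(b)\}$; for $P\colon A\to M^S$, $R^{P}=\{(s,t)\in S\times S\mid \forall a\in A:\ s(a)\leq t(P(a))\}$. -}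

module Defs where

open import Level using (Level; _⊔_; suc)
open import Data.Product using (Σ; _×_; proj₁)
open import Data.Empty using (⊥)
open import Relation.Nullary using (¬_)
open import Relation.Unary using (Pred)
open import Relation.Binary.Bundles using (Poset)
open import Function.Bundles using (_⇔_)

record CompleteLattice (c ℓ₁ ℓ₂ : Level) : Set (suc (c ⊔ ℓ₁ ⊔ ℓ₂)) where
  field
    poset : Poset c ℓ₁ ℓ₂
  open Poset poset public
  field
    ⋁        : {I : Set c} → (I → Carrier) → Carrier
    ⋁-upper  : {I : Set c} (f : I → Carrier) (i : I) → f i ≤ ⋁ f
    ⋁-least  : {I : Set c} (f : I → Carrier) (x : Carrier) →
               (∀ i → f i ≤ x) → ⋁ f ≤ x

  data Empty′ : Set c where

  𝟘 : Carrier
  𝟘 = ⋁ {I = Empty′} (λ ())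

  𝟙 : Carrier
  𝟙 = ⋁ {I = Carrier} (λ x → x)

  NonTrivial : Set ℓ₁
  NonTrivial = ¬ (𝟘 ≈ 𝟙)

module Power {c ℓ₁ ℓ₂ s : Level} (M : CompleteLattice c ℓ₁ ℓ₂) (S : Set s) where
  open CompleteLattice M

  Tuple : Set (s ⊔ c)
  Tuple = S → Carrier

  _≤ᵖ_ : Tuple → Tuple → Set (s ⊔ ℓ₂)
  m ≤ᵖ n = ∀ i → m i ≤ n i

  const : Carrier → Tuple
  const x = λ _ → x

  record BoundedSubposet {a : Level} (A : Pred Tuple a) : Set a where
    field
      has-0 : A (const 𝟘)
      has-1 : A (const 𝟙)

  El : {a : Level} → Pred Tuple a → Set (s ⊔ c ⊔ a)
  El A = Σ Tuple A

  OrderPreserving : {a : Level} {A : Pred Tuple a} → (El A → Tuple) → Set (s ⊔ c ⊔ a ⊔ ℓ₂)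
  OrderPreserving {A = A} F = ∀ (x y : El A) → proj₁ x ≤ᵖ proj₁ y → F x ≤ᵖ F y

  -- R_T = {(s,t) | ∀ b ∈ B, s(T b) ≤ t(b)}
  Rₗ : {b : Level} {B : Pred Tuple b} → (El B → Tuple) → S → S → Set (s ⊔ c ⊔ b ⊔ ℓ₂)
  Rₗ {B = B} T i j = ∀ (x : El B) → T x i ≤ proj₁ x j

  -- R^P = {(s,t) | ∀ a ∈ A, s(a) ≤ t(P a)}
  Rᵘ : {a : Level} {A : Pred Tuple a} → (El A → Tuple) → S → S → Set (s ⊔ c ⊔ a ⊔ ℓ₂)
  Rᵘ {A = A} P i j = ∀ (x : El A) → proj₁ x i ≤ P x j

  _⊆ᴿ_ : {r₁ r₂ : Level} → (S → S → Set r₁) → (S → S → Set r₂) → Set (s ⊔ r₁ ⊔ r₂)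
  R ⊆ᴿ R′ = ∀ i j → R i j → R′ i j

module Submission where

-- The hypothesis "P a ≤ b iff a ≤ T b" says that (P, T) is a
-- Galois connection between the subsets A and B of M^S.  Whenever P maps A
-- into B, the element P a may itself be fed to T, and the connection gives
-- the unit inequality a ≤ T (P a); dually, when T maps B into A, we get the
-- counit inequality P (T b) ≤ b.  These are the only facts needed:
--   (a) if (s,t) ∈ R_T then s(a) ≤ s(T(P a)) ≤ t(P a), so (s,t) ∈ R^P;
--   (b) if (s,t) ∈ R^P then s(T b) ≤ t(P(T b)) ≤ t(b), so (s,t) ∈ R_T;
--   (c) is the conjunction of (a) and (b).

open import Defs
open import Level using (Level; _⊔_)
open import Data.Product using (Σ; _×_; _,_; proj₁)
open import Relation.Unary using (Pred)
open import Function.Bundles using (_⇔_; Equivalence)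

module GaloisInclusions
  {c ℓ₁ ℓ₂ s a b : Level} (M : CompleteLattice c ℓ₁ ℓ₂) (S : Set s)
  where
  open CompleteLattice M
  open Power M S

  GaloisConnection : {A : Pred Tuple a} {B : Pred Tuple b} →
                     (El A → Tuple) → (El B → Tuple) → Set (s ⊔ c ⊔ a ⊔ b ⊔ ℓ₂)
  GaloisConnection {A} {B} P T =
    ∀ (x : El A) (y : El B) → (P x ≤ᵖ proj₁ y) ⇔ (proj₁ x ≤ᵖ T y)

  ≤ᵖ-refl : (m : Tuple) → m ≤ᵖ m
  ≤ᵖ-refl m i = refl

  unit : {A : Pred Tuple a} {B : Pred Tuple b}
         (P : El A → Tuple) (T : El B → Tuple) → GaloisConnection P T →
         (P-into-B : ∀ (x : El A) → B (P x)) →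
         ∀ (x : El A) → proj₁ x ≤ᵖ T (P x , P-into-B x)
  unit P T gal P-into-B x =
    Equivalence.to (gal x (P x , P-into-B x)) (≤ᵖ-refl (P x))

  counit : {A : Pred Tuple a} {B : Pred Tuple b}
           (P : El A → Tuple) (T : El B → Tuple) → GaloisConnection P T →
           (T-into-A : ∀ (y : El B) → A (T y)) →
           ∀ (y : El B) → P (T y , T-into-A y) ≤ᵖ proj₁ y
  counit P T gal T-into-A y =
    Equivalence.from (gal (T y , T-into-A y) y) (≤ᵖ-refl (T y))

  Rₗ⊆Rᵘ : {A : Pred Tuple a} {B : Pred Tuple b}
          (P : El A → Tuple) (T : El B → Tuple) → GaloisConnection P T →
          (∀ (x : El A) → B (P x)) → Rₗ {B = B} T ⊆ᴿ Rᵘ {A = A} P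
  Rₗ⊆Rᵘ P T gal P-into-B i j RTij x =
    trans (unit P T gal P-into-B x i) (RTij (P x , P-into-B x))

  Rᵘ⊆Rₗ : {A : Pred Tuple a} {B : Pred Tuple b}
          (P : El A → Tuple) (T : El B → Tuple) → GaloisConnection P T →
          (∀ (y : El B) → A (T y)) → Rᵘ {A = A} P ⊆ᴿ Rₗ {B = B} T
  Rᵘ⊆Rₗ P T gal T-into-A i j RPij y =
    trans (RPij (T y , T-into-A y)) (counit P T gal T-into-A y j)

lemma2p5 : {c ℓ₁ ℓ₂ s a b : Level} (M : CompleteLattice c ℓ₁ ℓ₂) (S : Set s) →
    let open CompleteLattice M
        open Power M S in
    NonTrivial → S →
    (A : Pred Tuple a) (B : Pred Tuple b) → BoundedSubposet A → BoundedSubposet B →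
    (P : El A → Tuple) (T : El B → Tuple) →
    OrderPreserving {A = A} P → OrderPreserving {A = B} T →
    (∀ (x : El A) (y : El B) → (P x ≤ᵖ proj₁ y) ⇔ (proj₁ x ≤ᵖ T y)) →
    ((∀ (x : El A) → B (P x)) → Rₗ {B = B} T ⊆ᴿ Rᵘ {A = A} P)
    × ((∀ (y : El B) → A (T y)) → Rᵘ {A = A} P ⊆ᴿ Rₗ {B = B} T)
    × ((∀ (x : El A) → B (P x)) → (∀ (y : El B) → A (T y)) →
       (Rₗ {B = B} T ⊆ᴿ Rᵘ {A = A} P) × (Rᵘ {A = A} P ⊆ᴿ Rₗ {B = B} T))
lemma2p5 M S _ _ A B _ _ P T _ _ gal =
  part-a , part-b , λ P-into-B T-into-A → part-a P-into-B , part-b T-into-A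
  where
  open CompleteLattice M
  open Power M S
  open GaloisInclusions M S

  part-a : (∀ (x : El A) → B (P x)) → Rₗ {B = B} T ⊆ᴿ Rᵘ {A = A} P
  part-a = Rₗ⊆Rᵘ P T gal

  part-b : (∀ (y : El B) → A (T y)) → Rᵘ {A = A} P ⊆ᴿ Rₗ {B = B} T
  part-b = Rᵘ⊆Rₗ P T gal
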